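{- Let $0<a_1<a_2<a_3$ be integers with $\gcd(a_1,a_2)=1$, and let $b_j,b'_j$ ($j\ge -1$) and $k$ be produced by the procedure described in the context, where it is assumed that $b_0>0$ and that the iteration halts after $k$ rounds. Then for every $0\le j\le k$ there is a positive integer $p_j$ such that $$b'_ja_2=b_ja_1+(-1)^j p_j a_3.$$
   Context: Procedure: set $b_{ -1}=a_2$ and $b'_{ -1}=a_1$. Let $b'_0,b_0$ be the unique integers with $0<b'_0\le a_1$ and $a_3=a_2b'_0-a_1b_0$. Assuming $b_0>0$, for $i=0,1,2,\dots$ do the following: if $b_i=0$ or $b'_i=0$, halt and set $k=i$. Otherwise let $q_i=\lfloor b_{i-1}/b_i\rfloor$, $q'_i=\lfloor b'_{i-1}/b'_i\rfloor$, $m_i=\min(q_i,q'_i)$, and define $b_{i+1}=b_{i-1}-m_ib_i$, $b'_{i+1}=b'_{i-1}-m_ib'_i$; if $q_i\neq q'_i$, halt and set $k=i+1$; otherwise continue with $i+1$. "The iteration halts after $k$ rounds" means it halts with this value of $k$. -}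

module Defs where

open import Data.Nat using (ℕ; zero; suc; _∸_; _*_; _⊓_; _<_; _≤_)
open import Data.Nat.DivMod using (_/_)
open import Data.Product using (_×_; _,_; Σ; proj₁; proj₂)
open import Data.Sum using (_⊎_)
open import Relation.Binary.PropositionalEquality using (_≡_; _≢_)

-- Floor division on ℕ, made total (value at divisor 0 is irrelevant:
-- it is only ever used when the divisor is nonzero).
⌊_/_⌋ : ℕ → ℕ → ℕ
⌊ x / zero ⌋ = zero
⌊ x / suc y ⌋ = x / suc y

-- State of the procedure at round i:
--   (b_{i-1} , b_i , b'_{i-1} , b'_i)
record State : Set where
  constructor st
  field
    prev  : ℕ
    cur   : ℕ
    prev' : ℕ
    cur'  : ℕ
open State public

-- All quantities are nonnegative (since b_{-1}, b_0, b'_{-1}, b'_0 > 0 and m ≤ q, m ≤ q'),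
-- so truncated subtraction on ℕ is exact.
step : State → State
step (st x y x' y') =
  let m = ⌊ x / y ⌋ ⊓ ⌊ x' / y' ⌋ in
  st y (x ∸ m * y) y' (x' ∸ m * y')

state : (a₁ a₂ b₀ b₀' : ℕ) → ℕ → State
state a₁ a₂ b₀ b₀' zero    = st a₂ b₀ a₁ b₀'
state a₁ a₂ b₀ b₀' (suc i) = step (state a₁ a₂ b₀ b₀' i)

module Procedure (a₁ a₂ b₀ b₀' : ℕ) where

  b : ℕ → ℕ
  b i = cur (state a₁ a₂ b₀ b₀' i)

  b' : ℕ → ℕ
  b' i = cur' (state a₁ a₂ b₀ b₀' i)

  q : ℕ → ℕ
  q i = ⌊ prev (state a₁ a₂ b₀ b₀' i) / b i ⌋

  q' : ℕ → ℕ
  q' i = ⌊ prev' (state a₁ a₂ b₀ b₀' i) / b' i ⌋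

  Continues : ℕ → Set
  Continues i = (b i ≢ 0) × (b' i ≢ 0) × (q i ≡ q' i)

  HaltsAfter : ℕ → Set
  HaltsAfter k =
      ( ((i : ℕ) → i < k → Continues i) × ((b k ≡ 0) ⊎ (b' k ≡ 0)) )
    ⊎ Σ ℕ (λ i → (k ≡ suc i)
                 × ((j : ℕ) → j < i → Continues j)
                 × (b i ≢ 0) × (b' i ≢ 0) × (q i ≢ q' i))

-- Write d(x, x') = x' a₂ − x a₁.  A round replaces (b_{i-1}, b'_{i-1}) by (b_{i-1}, b'_{i-1}) − m_i (b_i, b'_i),
-- and d is linear, so d_{i+1} = d_{i-1} − m_i d_i with d_{-1} = 0 and d_0 = a₃.  Hence d_i = (-1)^i p_i a₃
-- where p_{-1} = 0, p_0 = 1 and p_{i+1} = p_{i-1} + m_i p_i; the p_i are positive because m_0 ≥ 1,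
-- which follows from b_0 < a₂ and b'_0 ≤ a₁.  Neither halting nor gcd(a₁, a₂) = 1 plays a role:
-- the identity holds at every round.
module Submission where

open import Defs
open import Data.Nat using (ℕ; _<_; _≤_; _*_; _+_; _∸_; _⊓_; zero; suc; z≤n; s≤s)
open import Data.Nat.GCD using (gcd)
open import Data.Integer using (ℤ; +_; -1ℤ; _^_) renaming (_*_ to _*ℤ_; _+_ to _+ℤ_)
open import Data.Product using (_×_; Σ; _,_)
open import Data.Sum using (_⊎_; inj₁; inj₂)
open import Relation.Binary.PropositionalEquality using (_≡_; refl; subst; cong; cong₂; module ≡-Reasoning)
import Data.Nat.Properties as ℕ
import Data.Integer as ℤ
import Data.Integer.Properties as ℤ
open import Data.Nat.DivMod using (_/_; m/n*n≤m; m≥n⇒m/n>0)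
open import Data.Integer.Solver using (module +-*-Solver)
open +-*-Solver

⌊/⌋*n≤m : ∀ m n → ⌊ m / n ⌋ * n ≤ m
⌊/⌋*n≤m m zero    = z≤n
⌊/⌋*n≤m m (suc n) = m/n*n≤m m (suc n)

multiplier : State → ℕ
multiplier (st x y x' y') = ⌊ x / y ⌋ ⊓ ⌊ x' / y' ⌋

multiplier*cur≤prev : ∀ s → multiplier s * cur s ≤ prev s
multiplier*cur≤prev (st x y x' y') =
  ℕ.≤-trans (ℕ.*-monoˡ-≤ y (ℕ.m⊓n≤m ⌊ x / y ⌋ ⌊ x' / y' ⌋)) (⌊/⌋*n≤m x y)

multiplier*cur'≤prev' : ∀ s → multiplier s * cur' s ≤ prev' s
multiplier*cur'≤prev' (st x y x' y') =
  ℕ.≤-trans (ℕ.*-monoˡ-≤ y' (ℕ.m⊓n≤n ⌊ x / y ⌋ ⌊ x' / y' ⌋)) (⌊/⌋*n≤m x' y')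

pos-∸-* : ∀ m x y → m * y ≤ x → + (x ∸ m * y) ≡ + x ℤ.- + m *ℤ + y
pos-∸-* m x y m*y≤x = begin
  + (x ∸ m * y)      ≡⟨ ℤ.⊖-≥ m*y≤x ⟨
  x ℤ.⊖ m * y        ≡⟨ ℤ.m-n≡m⊖n x (m * y) ⟨
  + x ℤ.- + (m * y)  ≡⟨ cong (λ t → + x ℤ.- t) (ℤ.pos-* m y) ⟩
  + x ℤ.- + m *ℤ + y ∎
  where open ≡-Reasoning

module _ (a₁ a₂ a₃ : ℕ) where

  Defect : ℕ → ℕ → ℤ → Set
  Defect x x' t = + x' *ℤ + a₂ ≡ + x *ℤ + a₁ +ℤ t *ℤ + a₃

  Defect-∸ : ∀ {x y x' y' u v} m → m * y ≤ x → m * y' ≤ x' →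
             Defect x x' u → Defect y y' v → Defect (x ∸ m * y) (x' ∸ m * y') (u ℤ.- + m *ℤ v)
  Defect-∸ {x} {y} {x'} {y'} {u} {v} m m*y≤x m*y'≤x' dx dy = begin
    + (x' ∸ m * y') *ℤ + a₂
      ≡⟨ cong (_*ℤ + a₂) (pos-∸-* m x' y' m*y'≤x') ⟩
    (+ x' ℤ.- + m *ℤ + y') *ℤ + a₂
      ≡⟨ solve 4 (λ X' M Y' A₂ → (X' :- M :* Y') :* A₂ := X' :* A₂ :- M :* (Y' :* A₂))
               refl (+ x') (+ m) (+ y') (+ a₂) ⟩
    + x' *ℤ + a₂ ℤ.- + m *ℤ (+ y' *ℤ + a₂)
      ≡⟨ cong₂ (λ s t → s ℤ.- + m *ℤ t) dx dy ⟩
    (+ x *ℤ + a₁ +ℤ u *ℤ + a₃) ℤ.- + m *ℤ (+ y *ℤ + a₁ +ℤ v *ℤ + a₃)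
      ≡⟨ solve 7 (λ X A₁ U A₃ M Y V →
                    (X :* A₁ :+ U :* A₃) :- M :* (Y :* A₁ :+ V :* A₃)
                    := (X :- M :* Y) :* A₁ :+ (U :- M :* V) :* A₃)
               refl (+ x) (+ a₁) u (+ a₃) (+ m) (+ y) v ⟩
    (+ x ℤ.- + m *ℤ + y) *ℤ + a₁ +ℤ (u ℤ.- + m *ℤ v) *ℤ + a₃
      ≡⟨ cong (λ s → s *ℤ + a₁ +ℤ (u ℤ.- + m *ℤ v) *ℤ + a₃) (pos-∸-* m x y m*y≤x) ⟨
    + (x ∸ m * y) *ℤ + a₁ +ℤ (u ℤ.- + m *ℤ v) *ℤ + a₃ ∎
    where open ≡-Reasoning

  -- Invariant at a state (b_{i-1}, b_i, b'_{i-1}, b'_i) with S = (-1)^i, P = p_{i-1}, Q = p_i.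
  Alternating : ℤ → State → ℕ → ℕ → Set
  Alternating S (st x y x' y') P Q = Defect x x' (ℤ.- (S *ℤ + P)) × Defect y y' (S *ℤ + Q)

  Alternating-step : ∀ S s P Q → Alternating S s P Q →
                     Alternating (-1ℤ *ℤ S) (step s) Q (P + multiplier s * Q)
  Alternating-step S s@(st x y x' y') P Q (dx , dy) = dy′ , dz
    where
    m = multiplier s

    dy′ : Defect y y' (ℤ.- ((-1ℤ *ℤ S) *ℤ + Q))
    dy′ rewrite solve 2 (λ S Q → :- ((con -1ℤ :* S) :* Q) := S :* Q) refl S (+ Q) = dy

    sign-flip : ℤ.- (S *ℤ + P) ℤ.- + m *ℤ (S *ℤ + Q) ≡ (-1ℤ *ℤ S) *ℤ + (P + m * Q)
    sign-flip = begin
      ℤ.- (S *ℤ + P) ℤ.- + m *ℤ (S *ℤ + Q)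
        ≡⟨ solve 4 (λ S P M Q → :- (S :* P) :- M :* (S :* Q) := (con -1ℤ :* S) :* (P :+ M :* Q))
                 refl S (+ P) (+ m) (+ Q) ⟩
      (-1ℤ *ℤ S) *ℤ (+ P +ℤ + m *ℤ + Q)
        ≡⟨ cong (λ t → (-1ℤ *ℤ S) *ℤ (+ P +ℤ t)) (ℤ.pos-* m Q) ⟨
      (-1ℤ *ℤ S) *ℤ (+ P +ℤ + (m * Q))
        ≡⟨ cong ((-1ℤ *ℤ S) *ℤ_) (ℤ.pos-+ P (m * Q)) ⟨
      (-1ℤ *ℤ S) *ℤ + (P + m * Q) ∎
      where open ≡-Reasoning

    dz : Defect (x ∸ m * y) (x' ∸ m * y') ((-1ℤ *ℤ S) *ℤ + (P + m * Q))
    dz = subst (Defect (x ∸ m * y) (x' ∸ m * y')) sign-flip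
      (Defect-∸ {x} {y} {x'} {y'} {ℤ.- (S *ℤ + P)} {S *ℤ + Q} m
                (multiplier*cur≤prev s) (multiplier*cur'≤prev' s) dx dy)

  Alternating-state : ∀ b₀ b₀' → a₃ + a₁ * b₀ ≡ a₂ * b₀' → 0 < multiplier (st a₂ b₀ a₁ b₀') →
    ∀ i → Σ ℕ λ P → Σ ℕ λ Q →
      Alternating (-1ℤ ^ i) (state a₁ a₂ b₀ b₀' i) P Q × 0 < Q × (i ≡ 0 ⊎ 0 < P)
  Alternating-state b₀ b₀' a₃+a₁b₀≡a₂b₀' _ zero = 0 , 1 , (d₋₁ , d₀) , s≤s z≤n , inj₁ refl
    where
    d₋₁ : Defect a₂ a₁ (ℤ.- (ℤ.1ℤ *ℤ + 0))
    d₋₁ = solve 2 (λ A₁ A₂ → A₁ :* A₂ := A₂ :* A₁ :+ (:- (con ℤ.1ℤ :* con (+ 0))) :* con (+ a₃))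
                refl (+ a₁) (+ a₂)
    d₀ : Defect b₀ b₀' (ℤ.1ℤ *ℤ + 1)
    d₀ = begin
      + b₀' *ℤ + a₂             ≡⟨ ℤ.*-comm (+ b₀') (+ a₂) ⟩
      + a₂ *ℤ + b₀'             ≡⟨ ℤ.pos-* a₂ b₀' ⟨
      + (a₂ * b₀')              ≡⟨ cong +_ a₃+a₁b₀≡a₂b₀' ⟨
      + (a₃ + a₁ * b₀)          ≡⟨ ℤ.pos-+ a₃ (a₁ * b₀) ⟩
      + a₃ +ℤ + (a₁ * b₀)       ≡⟨ cong (+ a₃ +ℤ_) (ℤ.pos-* a₁ b₀) ⟩
      + a₃ +ℤ + a₁ *ℤ + b₀      ≡⟨ solve 3 (λ A₃ A₁ B₀ → A₃ :+ A₁ :* B₀ := B₀ :* A₁ :+ (con ℤ.1ℤ :* con (+ 1)) :* A₃)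
                                         refl (+ a₃) (+ a₁) (+ b₀) ⟩
      + b₀ *ℤ + a₁ +ℤ (ℤ.1ℤ *ℤ + 1) *ℤ + a₃ ∎
      where open ≡-Reasoning
  Alternating-state b₀ b₀' eq m₀>0 (suc i) with Alternating-state b₀ b₀' eq m₀>0 i
  ... | P , Q , alt , Q>0 , P-side =
    Q , P + multiplier s * Q , Alternating-step (-1ℤ ^ i) s P Q alt , positive P-side , inj₂ Q>0
    where
    s = state a₁ a₂ b₀ b₀' i
    positive : i ≡ 0 ⊎ 0 < P → 0 < P + multiplier s * Q
    positive (inj₂ P>0)  = ℕ.<-≤-trans P>0 (ℕ.m≤m+n P _)
    positive (inj₁ refl) = ℕ.<-≤-trans (ℕ.*-mono-< m₀>0 Q>0) (ℕ.m≤n+m _ P)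

b₀<a₂ : ∀ a₁ a₂ {a₃ b₀ b₀'} → 0 < a₃ → b₀' ≤ a₁ → a₃ + a₁ * b₀ ≡ a₂ * b₀' → b₀ < a₂
b₀<a₂ a₁ a₂ {a₃} {b₀} {b₀'} a₃>0 b₀'≤a₁ eq = ℕ.*-cancelˡ-< a₁ b₀ a₂ (begin-strict
  a₁ * b₀       <⟨ ℕ.m<n+m (a₁ * b₀) a₃>0 ⟩
  a₃ + a₁ * b₀  ≡⟨ eq ⟩
  a₂ * b₀'      ≤⟨ ℕ.*-monoʳ-≤ a₂ b₀'≤a₁ ⟩
  a₂ * a₁       ≡⟨ ℕ.*-comm a₂ a₁ ⟩
  a₁ * a₂       ∎)
  where open ℕ.≤-Reasoning

lemma4 : (a₁ a₂ a₃ : ℕ) → 0 < a₁ → a₁ < a₂ → a₂ < a₃ → gcd a₁ a₂ ≡ 1 →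
    (b₀ b₀' : ℕ) → 0 < b₀' → b₀' ≤ a₁ → a₃ + a₁ * b₀ ≡ a₂ * b₀' → 0 < b₀ →
    (k : ℕ) → Procedure.HaltsAfter a₁ a₂ b₀ b₀' k →
    (j : ℕ) → j ≤ k →
    Σ ℕ (λ p → (0 < p) ×
      ((+ Procedure.b' a₁ a₂ b₀ b₀' j) *ℤ (+ a₂)
        ≡ (+ Procedure.b a₁ a₂ b₀ b₀' j) *ℤ (+ a₁) +ℤ ((-1ℤ ^ j) *ℤ (+ p)) *ℤ (+ a₃)))
lemma4 a₁ a₂ a₃ a₁>0 a₁<a₂ a₂<a₃ _ (suc c) (suc c') _ b₀'≤a₁ eq _ _ _ j _
  with Alternating-state a₁ a₂ a₃ (suc c) (suc c') eq m₀>0 j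
  where
  a₃>0 : 0 < a₃
  a₃>0 = ℕ.<-trans (ℕ.<-trans a₁>0 a₁<a₂) a₂<a₃
  m₀>0 : 0 < multiplier (st a₂ (suc c) a₁ (suc c'))
  m₀>0 = ℕ.⊓-glb (m≥n⇒m/n>0 (ℕ.<⇒≤ (b₀<a₂ a₁ a₂ a₃>0 b₀'≤a₁ eq))) (m≥n⇒m/n>0 b₀'≤a₁)
... | P , Q , (_ , defect) , Q>0 , _ = Q , Q>0 , defect
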